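{- Let $d,d',s$ be positive integers such that every unweighted graph which, for every weight function $\mu$, has a $(d,1)$-coverable balanced separator for $\mu$, admits a tree decomposition whose every bag is $(d',s)$-coverable. Then for every positive integer $r$, every graph which, for every weight function $\mu$, has a $(d,r)$-coverable balanced separator for $\mu$, admits a tree decomposition whose every bag is $(d',4sr+r)$-coverable.
   Context: Graphs are finite, simple, unweighted, with shortest-path distance $\mathrm{dist}$. A set of vertices of a graph $F$ is $(d,\rho)$-coverable if it is contained in the union of $d$ balls $\mathrm{Ball}_F(u,\rho)=\{v:\mathrm{dist}_F(u,v)\le\rho\}$ of $F$. A weight function is a map $\mu:V(F)\to\mathbb{R}_{\ge0}$; $X\subseteq V(F)$ is a balanced separator for $\mu$ if every connected component $C$ of $F-X$ has $\mu(V(C))\le\frac12\mu(V(F))$.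
   Formalization: Weight functions μ take values in the nonnegative rationals instead of the nonnegative reals. -}

module Defs where

open import Data.Nat using (ℕ; zero; suc; _≤_; _<_)
open import Data.Fin using (Fin)
import Data.Fin as Fin
import Data.Vec as Vec
import Data.Fin.Subset as Sub
open import Data.Fin.Subset using (Subset; _∈_; _∉_)
open import Data.Bool using (Bool; true; false; if_then_else_)
open import Data.Rational using (ℚ; 0ℚ; ½) renaming (_+_ to _+ℚ_; _*_ to _*ℚ_; _≤_ to _≤ℚ_)
open import Data.Product using (Σ; ∃; ∃-syntax; _×_; _,_)
open import Data.Unit using (⊤)
open import Data.Empty using (⊥)
open import Data.List using (List; []; _∷_; length)
open import Data.List.Relation.Unary.Unique.Propositional using (Unique)
open import Relation.Binary.PropositionalEquality using (_≡_; _≢_)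
open import Relation.Nullary using (¬_)

record Graph : Set where
  field
    n     : ℕ
    E     : Fin n → Fin n → Bool
    sym   : ∀ u v → E u v ≡ E v u
    irref : ∀ u → E u u ≡ false
open Graph public

V : Graph → Set
V G = Fin (n G)

Adj : (G : Graph) → V G → V G → Set
Adj G u v = E G u v ≡ true

data WalkIn (G : Graph) (P : V G → Set) : V G → V G → ℕ → Set where
  here : ∀ {u} → P u → WalkIn G P u u 0
  step : ∀ {u v w k} → P u → Adj G u v → WalkIn G P v w k → WalkIn G P u w (suc k)

-- dist_G(u,v) ≤ ρ  (dist is the least length of a walk)
DistLe : (G : Graph) → V G → V G → ℕ → Set
DistLe G u v ρ = ∃[ k ] (k ≤ ρ × WalkIn G (λ _ → ⊤) u v k)

InBall : (G : Graph) → V G → ℕ → V G → Set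
InBall G u ρ v = DistLe G u v ρ

Coverable : (G : Graph) → ℕ → ℕ → (V G → Set) → Set
Coverable G d ρ S =
  ∃[ k ] (k ≤ d × Σ (Fin k → V G) λ c → ∀ v → S v → ∃[ i ] InBall G (c i) ρ v)

ConnectedIn : (G : Graph) → (V G → Set) → Set
ConnectedIn G P = ∀ u w → P u → P w → ∃[ k ] WalkIn G P u w k

IsComponent : (G : Graph) → Subset (n G) → Subset (n G) → Set
IsComponent G X C =
    (∃[ v ] v ∈ C)
  × (∀ v → v ∈ C → v ∉ X)
  × ConnectedIn G (λ v → v ∈ C)
  × (∀ u w → u ∈ C → w ∉ X → Adj G u w → w ∈ C)

sumFin : ∀ {m} → (Fin m → ℚ) → ℚ
sumFin {zero}  f = 0ℚ
sumFin {suc m} f = f Fin.zero +ℚ sumFin (λ i → f (Fin.suc i))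

weight : ∀ {m} → (Fin m → ℚ) → Subset m → ℚ
weight μ C = sumFin (λ v → if Vec.lookup C v then μ v else 0ℚ)

WeightFn : Graph → Set
WeightFn G = V G → ℚ

NonNeg : (G : Graph) → WeightFn G → Set
NonNeg G μ = ∀ v → 0ℚ ≤ℚ μ v

BalancedSeparator : (G : Graph) → WeightFn G → Subset (n G) → Set
BalancedSeparator G μ X =
  ∀ C → IsComponent G X C → weight μ C ≤ℚ (½ *ℚ weight μ Sub.⊤)

HasCoverableBalancedSeparators : Graph → ℕ → ℕ → Set
HasCoverableBalancedSeparators G d ρ =
  (μ : WeightFn G) → NonNeg G μ →
  Σ (Subset (n G)) λ X → Coverable G d ρ (λ v → v ∈ X) × BalancedSeparator G μ X

data PathFrom (G : Graph) : V G → List (V G) → V G → Set where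
  one  : ∀ {u} → PathFrom G u (u ∷ []) u
  cons : ∀ {u v w vs} → Adj G u v → PathFrom G v vs w → PathFrom G u (u ∷ vs) w

HasCycle : Graph → Set
HasCycle G = ∃[ u ] ∃[ w ] Σ (List (V G)) λ vs →
  PathFrom G u vs w × Unique vs × 3 ≤ length vs × Adj G w u

IsTree : Graph → Set
IsTree T = (0 < n T) × ConnectedIn T (λ _ → ⊤) × ¬ HasCycle T

record TreeDecomposition (G : Graph) : Set where
  field
    T        : Graph
    isTree   : IsTree T
    bag      : V T → Subset (n G)
    vCovered : ∀ v → ∃[ t ] v ∈ bag t
    eCovered : ∀ u v → Adj G u v → ∃[ t ] (u ∈ bag t × v ∈ bag t)
    coherent : ∀ v → ConnectedIn T (λ t → v ∈ bag t)
open TreeDecomposition public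

HasCoverableTD : Graph → ℕ → ℕ → Set
HasCoverableTD G d ρ =
  Σ (TreeDecomposition G) λ D → ∀ t → Coverable G d ρ (λ v → v ∈ bag D t)

{-# OPTIONS --safe #-}
-- Let H = G^{2r} join distinct vertices at G-distance at most 2r. If the balanced
-- separator X of G is covered by the r-balls around c₁, …, c_d, then the union Y of
-- the 2r-balls around the cᵢ is covered by d unit balls of H, and Y is balanced in H:
-- an H-edge between vertices outside Y comes from a G-walk of length ≤ 2r, each of
-- whose vertices lies within r of an endpoint and hence outside X (else that
-- endpoint would be within 2r of some cᵢ), so every component of H − Y lies inside
-- a component of G − X. The hypothesis gives a tree
-- decomposition of H with (d', s)-coverable bags; it is one of G as well, since
-- G ⊆ H, and an s-ball of H lies in a 2rs-ball of G, with 2rs ≤ 4sr + r.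
module Submission where

open import Defs
open import Data.Nat using (ℕ; _≤_; _+_; _*_; zero; suc; z≤n; s≤s)
open import Data.Nat.Properties
  using ( ≤-refl; ≤-reflexive; ≤-trans; <-≤-trans; m≤m+n; m≤n⇒m≤1+n; m+n≤o⇒n≤o
        ; +-mono-≤; *-monoˡ-≤; 1+n≰n)
open import Data.Nat.Solver using (module +-*-Solver)
open import Data.Fin using (Fin; _≟_)
import Data.Fin as Fin
open import Data.Fin.Properties using (any?)
open import Data.Fin.Subset using (Subset; _∈_; _∉_; _⊆_; ∣_∣)
open import Data.Fin.Subset.Properties using (_∈?_; _⊂?_; p⊂q⇒∣p∣<∣q∣; ∣p∣≤n)
open import Data.Vec using (tabulate; lookup)
open import Data.Vec.Properties using (lookup∘tabulate; []=⇒lookup; lookup⇒[]=)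
open import Data.Bool using (true; false; if_then_else_) renaming (_≟_ to _≟ᵇ_)
open import Data.Rational using (ℚ; 0ℚ) renaming (_+_ to _+ℚ_; _≤_ to _≤ℚ_)
import Data.Rational.Properties as ℚ
open import Data.Product using (∃-syntax; _×_; _,_; proj₁; proj₂)
import Data.Product as Product
open import Data.Sum using (_⊎_; inj₁; inj₂)
import Data.Sum as Sum
open import Data.Unit using (⊤; tt)
open import Function using (_∘_)
open import Function.Bundles using (mk⇔)
open import Relation.Binary.PropositionalEquality using (_≡_; _≢_; refl; trans; cong; ≢-sym)
import Relation.Binary.PropositionalEquality as ≡
open import Relation.Nullary using (Dec; yes; no; does; ¬?; _×-dec_; contradiction)
open import Relation.Nullary.Decidable using (dec-true; dec-false; does-⇔; decidable-stable)
open import Relation.Unary using (Pred; Decidable)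
open import Level using (0ℓ)

true⇒witness : ∀ {A : Set} (a? : Dec A) → does a? ≡ true → A
true⇒witness (yes a) _ = a

module _ {n} {P : Pred (Fin n) 0ℓ} (P? : Decidable P) where

  subset : Subset n
  subset = tabulate (does ∘ P?)

  ∈-subset⁺ : ∀ {x} → P x → x ∈ subset
  ∈-subset⁺ {x} p =
    lookup⇒[]= x subset (trans (lookup∘tabulate (does ∘ P?) x) (dec-true (P? x) p))

  ∈-subset⁻ : ∀ {x} → x ∈ subset → P x
  ∈-subset⁻ {x} x∈ =
    true⇒witness (P? x) (trans (≡.sym (lookup∘tabulate (does ∘ P?) x)) ([]=⇒lookup x∈))

⊆-chain-stabilises : ∀ {n} (A : ℕ → Subset n) → (∀ j → A j ⊆ A (suc j)) →
                     ∃[ j ] A (suc j) ⊆ A j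
⊆-chain-stabilises {n} A A⊆ with stabilises-or-grows (suc n)
  where
  stabilises-or-grows : ∀ j → (∃[ i ] A (suc i) ⊆ A i) ⊎ (j ≤ ∣ A j ∣)
  stabilises-or-grows zero = inj₂ z≤n
  stabilises-or-grows (suc j) with stabilises-or-grows j
  ... | inj₁ stable = inj₁ stable
  ... | inj₂ j≤∣Aj∣ with A j ⊂? A (suc j)
  ...   | yes Aj⊂ = inj₂ (<-≤-trans (s≤s j≤∣Aj∣) (p⊂q⇒∣p∣<∣q∣ Aj⊂))
  ...   | no Aj⊄ = inj₁ (j , λ {x} x∈ →
                       decidable-stable (x ∈? A j) λ x∉ → Aj⊄ (A⊆ j , x , x∈ , x∉))
... | inj₁ stable = stable
... | inj₂ n<∣A∣ = contradiction (≤-trans n<∣A∣ (∣p∣≤n (A (suc n)))) 1+n≰n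

sumFin-mono-≤ : ∀ {m} {f g : Fin m → ℚ} → (∀ i → f i ≤ℚ g i) → sumFin f ≤ℚ sumFin g
sumFin-mono-≤ {zero}  f≤g = ℚ.≤-refl
sumFin-mono-≤ {suc m} f≤g = ℚ.+-mono-≤ (f≤g Fin.zero) (sumFin-mono-≤ (f≤g ∘ Fin.suc))

weight-mono-⊆ : ∀ {m} {μ : Fin m → ℚ} → (∀ v → 0ℚ ≤ℚ μ v) →
                ∀ {C D} → C ⊆ D → weight μ C ≤ℚ weight μ D
weight-mono-⊆ {μ = μ} μ≥0 {C} {D} C⊆D = sumFin-mono-≤ pointwise
  where
  pointwise : ∀ v → (if lookup C v then μ v else 0ℚ) ≤ℚ (if lookup D v then μ v else 0ℚ)
  pointwise v with lookup C v in v∈C | lookup D v in v∈D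
  ... | true  | true  = ℚ.≤-refl
  ... | true  | false = contradiction
                          (trans (≡.sym ([]=⇒lookup (C⊆D (lookup⇒[]= v C v∈C)))) v∈D) λ ()
  ... | false | true  = μ≥0 v
  ... | false | false = ℚ.≤-refl

≤-+-split : ∀ {i k} ρ σ → i + k ≤ ρ + σ → i ≤ ρ ⊎ k ≤ σ
≤-+-split {zero}  ρ       σ _         = inj₁ z≤n
≤-+-split {suc i} zero    σ i+k≤σ     = inj₂ (m+n≤o⇒n≤o (suc i) i+k≤σ)
≤-+-split {suc i} (suc ρ) σ (s≤s i+k≤) = Sum.map₁ s≤s (≤-+-split ρ σ i+k≤)

module Walks (G : Graph) where

  Walk : V G → V G → ℕ → Set
  Walk = WalkIn G (λ _ → ⊤)

  WalkLe : Pred (V G) 0ℓ → V G → V G → ℕ → Set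
  WalkLe P u v ρ = ∃[ k ] (k ≤ ρ × WalkIn G P u v k)

  Adj-sym : ∀ {u v} → Adj G u v → Adj G v u
  Adj-sym {u} {v} e = trans (Graph.sym G v u) e

  adj? : ∀ u v → Dec (Adj G u v)
  adj? u v = E G u v ≟ᵇ true

  module _ {P : Pred (V G) 0ℓ} where

    WalkIn-start : ∀ {a b k} → WalkIn G P a b k → P a
    WalkIn-start (here p)     = p
    WalkIn-start (step p _ _) = p

    WalkIn-end : ∀ {a b k} → WalkIn G P a b k → P b
    WalkIn-end (here p)     = p
    WalkIn-end (step _ _ w) = WalkIn-end w

    _++ʷ_ : ∀ {a b c k m} → WalkIn G P a b k → WalkIn G P b c m → WalkIn G P a c (k + m)
    here _     ++ʷ w′ = w′
    step p e w ++ʷ w′ = step p e (w ++ʷ w′)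

    snocʷ : ∀ {a b c k} → WalkIn G P a b k → Adj G b c → P c → WalkIn G P a c (suc k)
    snocʷ (here p)      e q = step p e (here q)
    snocʷ (step p e′ w) e q = step p e′ (snocʷ w e q)

    reverseʷ : ∀ {a b k} → WalkIn G P a b k → WalkIn G P b a k
    reverseʷ (here p)     = here p
    reverseʷ (step p e w) = snocʷ (reverseʷ w) (Adj-sym e) p

    walkLe? : Decidable P → ∀ u v ρ → Dec (WalkLe P u v ρ)
    walkLe? P? u v zero with P? u | u ≟ v
    ... | no ¬pu | _        = no λ (_ , _ , w) → ¬pu (WalkIn-start w)
    ... | yes pu | yes refl = yes (0 , z≤n , here pu)
    ... | yes _  | no u≢v   = no λ { (_ , z≤n , here _) → u≢v refl }
    walkLe? P? u v (suc ρ) with P? u | u ≟ v | any? (λ w → adj? u w ×-dec walkLe? P? w v ρ)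
    ... | no ¬pu | _        | _ = no λ (_ , _ , w) → ¬pu (WalkIn-start w)
    ... | yes pu | yes refl | _ = yes (0 , z≤n , here pu)
    ... | yes pu | no _     | yes (w , e , k , k≤ρ , p) = yes (suc k , s≤s k≤ρ , step pu e p)
    ... | yes _  | no u≢v   | no ¬step = no λ
      { (0 , _ , here _)                → u≢v refl
      ; (suc k , s≤s k≤ρ , step _ e p) → ¬step (_ , e , k , k≤ρ , p) }

  mapʷ : ∀ {P Q : Pred (V G) 0ℓ} {a b k} → (∀ {x} → P x → Q x) →
         WalkIn G P a b k → WalkIn G Q a b k
  mapʷ f (here p)     = here (f p)
  mapʷ f (step p e w) = step (f p) e (mapʷ f w)

  WalkIn-closed : ∀ {P Q : Pred (V G) 0ℓ} {a b k} →
                  (∀ u w → Q u → P w → Adj G u w → Q w) →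
                  Q a → WalkIn G P a b k → WalkIn G Q a b k
  WalkIn-closed closed qa (here _)     = here qa
  WalkIn-closed closed qa (step _ e w) =
    step qa e (WalkIn-closed closed (closed _ _ qa (WalkIn-start w) e) w)

  WalkIn-by-splits : ∀ {Q : Pred (V G) 0ℓ} {a b k} →
                     (∀ {x i j} → Walk a x i → Walk x b j → i + j ≡ k → Q x) →
                     Walk a b k → WalkIn G Q a b k
  WalkIn-by-splits split (here _) = here (split (here tt) (here tt) refl)
  WalkIn-by-splits split (step _ e w) =
    step (split (here tt) (step tt e w) refl)
         e (WalkIn-by-splits (λ pre suf i+j≡k → split (step tt e pre) suf (cong suc i+j≡k)) w)

  DistLe? : ∀ u v ρ → Dec (DistLe G u v ρ)
  DistLe? = walkLe? (λ _ → yes tt)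

  DistLe-refl : ∀ {u ρ} → DistLe G u u ρ
  DistLe-refl = 0 , z≤n , here tt

  DistLe-sym : ∀ {u v ρ} → DistLe G u v ρ → DistLe G v u ρ
  DistLe-sym (k , k≤ρ , w) = k , k≤ρ , reverseʷ w

  DistLe-trans : ∀ {u v w ρ σ} → DistLe G u v ρ → DistLe G v w σ → DistLe G u w (ρ + σ)
  DistLe-trans (k , k≤ρ , w) (m , m≤σ , w′) = k + m , +-mono-≤ k≤ρ m≤σ , w ++ʷ w′

  DistLe-mono : ∀ {u v ρ σ} → ρ ≤ σ → DistLe G u v ρ → DistLe G u v σ
  DistLe-mono ρ≤σ (k , k≤ρ , w) = k , ≤-trans k≤ρ ρ≤σ , w

  Adj⇒DistLe : ∀ {u v ρ} → 1 ≤ ρ → Adj G u v → DistLe G u v ρ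
  Adj⇒DistLe 1≤ρ e = 1 , 1≤ρ , step tt e (here tt)

  Walk-in-end-balls : ∀ {Q : Pred (V G) 0ℓ} {a b k} ρ σ → k ≤ ρ + σ →
                (∀ x → DistLe G a x ρ ⊎ DistLe G x b σ → Q x) →
                Walk a b k → WalkIn G Q a b k
  Walk-in-end-balls ρ σ k≤ρ+σ near = WalkIn-by-splits λ {x} {i} {j} pre suf i+j≡k →
    near x (Sum.map (λ i≤ρ → i , i≤ρ , pre) (λ j≤σ → j , j≤σ , suf)
                    (≤-+-split ρ σ (≤-trans (≤-reflexive i+j≡k) k≤ρ+σ)))

  Coverable-mono-radius : ∀ {d ρ σ S} → ρ ≤ σ → Coverable G d ρ S → Coverable G d σ S
  Coverable-mono-radius ρ≤σ (k , k≤d , c , cover) =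
    k , k≤d , c , λ v Sv → Product.map₂ (DistLe-mono ρ≤σ) (cover v Sv)

module Power (G : Graph) (ρ : ℕ) where
  open Walks G

  power-adj? : ∀ u v → Dec (u ≢ v × DistLe G u v ρ)
  power-adj? u v = ¬? (u ≟ v) ×-dec DistLe? u v ρ

  power : Graph
  power = record
    { n     = n G
    ; E     = λ u v → does (power-adj? u v)
    ; sym   = λ u v → does-⇔ (mk⇔ swap swap) (power-adj? u v) (power-adj? v u)
    ; irref = λ u → dec-false (power-adj? u u) λ (u≢u , _) → u≢u refl
    }
    where
    swap : ∀ {u v} → u ≢ v × DistLe G u v ρ → v ≢ u × DistLe G v u ρ
    swap = Product.map ≢-sym DistLe-sym

  Adj-power⇒DistLe : ∀ {u v} → Adj power u v → DistLe G u v ρ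
  Adj-power⇒DistLe {u} {v} e = proj₂ (true⇒witness (power-adj? u v) e)

  DistLe⇒Adj-power : ∀ {u v} → u ≢ v → DistLe G u v ρ → Adj power u v
  DistLe⇒Adj-power {u} {v} u≢v d = dec-true (power-adj? u v) (u≢v , d)

  Adj⇒Adj-power : 1 ≤ ρ → ∀ {u v} → Adj G u v → Adj power u v
  Adj⇒Adj-power 1≤ρ {u} {v} e = DistLe⇒Adj-power u≢v (Adj⇒DistLe 1≤ρ e)
    where
    u≢v : u ≢ v
    u≢v refl = contradiction (trans (≡.sym e) (irref G u)) λ ()

  DistLe⇒power-ball : ∀ {u v} → DistLe G u v ρ → InBall power u 1 v
  DistLe⇒power-ball {u} {v} d with u ≟ v
  ... | yes refl = 0 , z≤n , here tt
  ... | no u≢v   = 1 , ≤-refl , step tt (DistLe⇒Adj-power u≢v d) (here tt)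

  power-walk⇒DistLe : ∀ {u v k} → WalkIn power (λ _ → ⊤) u v k → DistLe G u v (k * ρ)
  power-walk⇒DistLe (here _)     = DistLe-refl
  power-walk⇒DistLe (step _ e w) = DistLe-trans (Adj-power⇒DistLe e) (power-walk⇒DistLe w)

  Coverable-power : ∀ {d s S} → Coverable power d s S → Coverable G d (s * ρ) S
  Coverable-power (k , k≤d , c , cover) = k , k≤d , c , λ v Sv →
    Product.map₂ (λ (m , m≤s , w) → DistLe-mono (*-monoˡ-≤ ρ m≤s) (power-walk⇒DistLe w))
                 (cover v Sv)

  TreeDecomposition-power : 1 ≤ ρ → TreeDecomposition power → TreeDecomposition G
  TreeDecomposition-power 1≤ρ D = record
    { T        = T D
    ; isTree   = isTree D
    ; bag      = bag D
    ; vCovered = vCovered D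
    ; eCovered = λ u v e → eCovered D u v (Adj⇒Adj-power 1≤ρ e)
    ; coherent = coherent D
    }

module Components (G : Graph) (X : Subset (n G)) where
  open Walks G

  Outside : Pred (V G) 0ℓ
  Outside v = v ∉ X

  IsComponent-walk-closed : ∀ {D a b k} → IsComponent G X D →
                            a ∈ D → WalkIn G Outside a b k → b ∈ D
  IsComponent-walk-closed (_ , _ , _ , closed) a∈D w = WalkIn-end (WalkIn-closed closed a∈D w)

  -- The sets of vertices reachable from v₀ outside X in at most j steps form an
  -- increasing chain; its stable value is the component of v₀.
  component-of : ∀ {v₀} → v₀ ∉ X → ∃[ D ] (IsComponent G X D × v₀ ∈ D)
  component-of {v₀} v₀∉X = D , ((v₀ , v₀∈D) , D-outside , D-connected , D-closed) , v₀∈D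
    where
    reach? : ∀ j w → Dec (WalkLe Outside v₀ w j)
    reach? j w = walkLe? (λ x → ¬? (x ∈? X)) v₀ w j

    reach : ℕ → Subset (n G)
    reach j = subset (reach? j)

    reach-⊆ : ∀ j → reach j ⊆ reach (suc j)
    reach-⊆ j x∈ with ∈-subset⁻ (reach? j) x∈
    ... | k , k≤j , w = ∈-subset⁺ (reach? (suc j)) (k , m≤n⇒m≤1+n k≤j , w)

    stable : ∃[ j ] reach (suc j) ⊆ reach j
    stable = ⊆-chain-stabilises reach reach-⊆

    D : Subset (n G)
    D = reach (proj₁ stable)

    path-to : ∀ {x} → x ∈ D → WalkLe Outside v₀ x (proj₁ stable)
    path-to = ∈-subset⁻ (reach? (proj₁ stable))

    v₀∈D : v₀ ∈ D
    v₀∈D = ∈-subset⁺ (reach? (proj₁ stable)) (0 , z≤n , here v₀∉X)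

    D-outside : ∀ v → v ∈ D → v ∉ X
    D-outside v v∈D = WalkIn-end (proj₂ (proj₂ (path-to v∈D)))

    D-closed : ∀ u w → u ∈ D → w ∉ X → Adj G u w → w ∈ D
    D-closed u w u∈D w∉X e with path-to u∈D
    ... | k , k≤j , p = proj₂ stable
      (∈-subset⁺ (reach? (suc (proj₁ stable))) (suc k , s≤s k≤j , snocʷ p e w∉X))

    path-in-D : ∀ {x} → x ∈ D → ∃[ k ] WalkIn G (_∈ D) v₀ x k
    path-in-D x∈D with path-to x∈D
    ... | k , _ , p = k , WalkIn-closed D-closed v₀∈D p

    D-connected : ConnectedIn G (_∈ D)
    D-connected u w u∈D w∈D with path-in-D u∈D | path-in-D w∈D
    ... | k , p | m , q = k + m , reverseʷ p ++ʷ q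

module PowerSeparator (G : Graph) (r : ℕ) (X : Subset (n G))
                      {k} (c : Fin k → V G) (X⊆balls : ∀ v → v ∈ X → ∃[ i ] InBall G (c i) r v)
                      where
  open Walks G
  open Power G (r + r)
  open Components G X
  module H = Walks power

  near? : ∀ z → Dec (∃[ i ] DistLe G (c i) z (r + r))
  near? z = any? λ i → DistLe? (c i) z (r + r)

  Y : Subset (n G)
  Y = subset near?

  Y-coverable : ∀ {d} → k ≤ d → Coverable power d 1 (_∈ Y)
  Y-coverable k≤d = k , k≤d , c , λ z z∈Y → Product.map₂ DistLe⇒power-ball (∈-subset⁻ near? z∈Y)

  ball-outside-Y-avoids-X : ∀ {z w} → z ∉ Y → DistLe G z w r → w ∉ X
  ball-outside-Y-avoids-X z∉Y zw w∈X with X⊆balls _ w∈X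
  ... | i , cw = z∉Y (∈-subset⁺ near? (i , DistLe-trans cw (DistLe-sym zw)))

  power-edge-avoids-X : ∀ {a b} → a ∉ Y → b ∉ Y → Adj power a b → ∃[ m ] WalkIn G Outside a b m
  power-edge-avoids-X a∉Y b∉Y e with Adj-power⇒DistLe e
  ... | m , m≤2r , w = m , Walk-in-end-balls r r m≤2r near-end w
    where
    near-end : ∀ x → DistLe G _ x r ⊎ DistLe G x _ r → x ∉ X
    near-end x (inj₁ ax) = ball-outside-Y-avoids-X a∉Y ax
    near-end x (inj₂ xb) = ball-outside-Y-avoids-X b∉Y (DistLe-sym xb)

  power-walk-avoids-X : ∀ {a b k} → WalkIn power (_∉ Y) a b k → ∃[ m ] WalkIn G Outside a b m
  power-walk-avoids-X (here a∉Y) = 0 , here (ball-outside-Y-avoids-X a∉Y DistLe-refl)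
  power-walk-avoids-X (step a∉Y e w)
    with power-edge-avoids-X a∉Y (H.WalkIn-start w) e | power-walk-avoids-X w
  ... | m , p | m′ , q = m + m′ , p ++ʷ q

  component⊆component : ∀ {C D v} → IsComponent power Y C → IsComponent G X D →
                        v ∈ C → v ∈ D → C ⊆ D
  component⊆component {v = v} (_ , C-outside , C-connected , _) D-comp v∈C v∈D {x} x∈C
    with C-connected v x v∈C x∈C
  ... | _ , w with power-walk-avoids-X (H.mapʷ (C-outside _) w)
  ... | _ , w′ = IsComponent-walk-closed D-comp v∈D w′

  Y-balanced : ∀ μ → NonNeg G μ → BalancedSeparator G μ X → BalancedSeparator power μ Y
  Y-balanced μ μ≥0 X-balanced C C-comp@((v , v∈C) , C-outside , _)
    with component-of (ball-outside-Y-avoids-X (C-outside v v∈C) DistLe-refl)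
  ... | D , D-comp , v∈D =
    ℚ.≤-trans (weight-mono-⊆ μ≥0 (component⊆component C-comp D-comp v∈C v∈D)) (X-balanced D D-comp)

HasCoverableBalancedSeparators-power : ∀ G d r → HasCoverableBalancedSeparators G d r →
  HasCoverableBalancedSeparators (Power.power G (r + r)) d 1
HasCoverableBalancedSeparators-power G d r separators μ μ≥0 with separators μ μ≥0
... | X , (k , k≤d , c , X⊆balls) , X-balanced = Y , Y-coverable k≤d , Y-balanced μ μ≥0 X-balanced
  where open PowerSeparator G r X c X⊆balls

radius-bound : ∀ s r → s * (r + r) ≤ 4 * s * r + r
radius-bound s r = ≤-trans (m≤m+n (s * (r + r)) (2 * s * r + r)) (≤-reflexive (≡.sym expand))
  where
  open +-*-Solver
  expand : 4 * s * r + r ≡ s * (r + r) + (2 * s * r + r)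
  expand = solve 2 (λ s r → con 4 :* s :* r :+ r := s :* (r :+ r) :+ (con 2 :* s :* r :+ r)) refl s r

theorem6p3 : (d d' s : ℕ) → 1 ≤ d → 1 ≤ d' → 1 ≤ s →
    ((G : Graph) → HasCoverableBalancedSeparators G d 1 → HasCoverableTD G d' s) →
    (r : ℕ) → 1 ≤ r →
    (G : Graph) → HasCoverableBalancedSeparators G d r →
    HasCoverableTD G d' (4 * s * r + r)
theorem6p3 d d' s _ _ _ unit-separators⇒td r 1≤r G separators =
  TreeDecomposition-power 1≤r+r (proj₁ td) ,
  λ t → Coverable-mono-radius (radius-bound s r) (Coverable-power (proj₂ td t))
  where
  open Walks G
  open Power G (r + r)

  td : HasCoverableTD power d' s
  td = unit-separators⇒td power (HasCoverableBalancedSeparators-power G d r separators)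

  1≤r+r : 1 ≤ r + r
  1≤r+r = ≤-trans 1≤r (m≤m+n r r)
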